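{- Let $A,B$ be finite alphabets with $|A|=n$, $\phi\colon A^*\to A^*$ a $k$-uniform morphism, $h\colon A\to B$ a coding and $s\in A$ such that $\phi$ is prolongable on $s$, and assume every symbol of $A$ occurs in $\phi^\infty(s)$. For $m\in\mathbb{N}$ let $b\sim_m c$ iff $h(\phi^m(b))=h(\phi^m(c))$. Then for every $r\ge B_n$: $h(\phi^\infty(s))$ is almost periodic if and only if the symbols that are $\sim_r$-equivalent to $s$ occur in $\phi^\infty(s)$ infinitely often with bounded distances (i.e. the set of positions $i$ with $\phi^\infty(s)(i)\sim_r s$ is infinite and consecutive such positions are at bounded distance).
   Context: A morphism satisfies $\phi(uv)=\phi(u)\phi(v)$; it is $k$-uniform if $|\phi(a)|=k$ for all $a\in A$. A coding is a letter-to-letter map $h\colon A\to B$ extended letterwise. $\phi$ is prolongable on $s$ if $s$ is the first letter of $\phi(s)$ and $\phi^\infty(s)=\lim_m\phi^m(s)$ is infinite. $B_n$ is the Bell number (number of equivalence relations on an $n$-element set). A sequence $x$ is almost periodic if for every factor $u$ of $x$ there is $l$ such that every factor of $x$ of length $l$ contains an occurrence of $u$. -}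

module Defs where

open import Data.Nat using (ℕ; zero; suc; _+_; _*_; _∸_; _≤_; _<_)
open import Data.Fin using (Fin; fromℕ<)
open import Data.List using (List; []; _∷_; length; concatMap; map; lookup; upTo)
open import Data.Product using (Σ; ∃; _×_; _,_)
open import Relation.Binary.PropositionalEquality using (_≡_)

Morphism : Set → Set
Morphism A = A → List A

apply : {A : Set} → Morphism A → List A → List A
apply φ w = concatMap φ w

iter : {A : Set} → Morphism A → ℕ → List A → List A
iter φ zero    w = w
iter φ (suc m) w = apply φ (iter φ m w)

Uniform : {A : Set} → ℕ → Morphism A → Set
Uniform {A} k φ = (a : A) → length (φ a) ≡ k

-- φ is prolongable on s: s is the first letter of φ(s), and the words
-- φ^m(s) have unbounded length (so φ^∞(s) is infinite)
Prolongable : {A : Set} → Morphism A → A → Set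
Prolongable φ s =
  (∃ λ w → φ s ≡ s ∷ w) × ((N : ℕ) → ∃ λ m → N < length (iter φ m (s ∷ [])))

IsLimit : {A : Set} → Morphism A → A → (ℕ → A) → Set
IsLimit φ s x =
  (m i : ℕ) (p : i < length (iter φ m (s ∷ []))) →
  x i ≡ lookup (iter φ m (s ∷ [])) (fromℕ< p)

Equiv : {A B : Set} → Morphism A → (A → B) → ℕ → A → A → Set
Equiv φ h m b c = map h (iter φ m (b ∷ [])) ≡ map h (iter φ m (c ∷ []))

stirling2 : ℕ → ℕ → ℕ
stirling2 zero    zero    = 1
stirling2 zero    (suc j) = 0
stirling2 (suc n) zero    = 0
stirling2 (suc n) (suc j) = suc j * stirling2 n (suc j) + stirling2 n j

sumTo : (ℕ → ℕ) → ℕ → ℕ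
sumTo f zero    = f zero
sumTo f (suc j) = sumTo f j + f (suc j)

bell : ℕ → ℕ
bell n = sumTo (stirling2 n) n

factor : {B : Set} → (ℕ → B) → ℕ → ℕ → List B
factor y i len = map (λ t → y (i + t)) (upTo len)

AlmostPeriodic : {B : Set} → (ℕ → B) → Set
AlmostPeriodic y =
  (i len : ℕ) → ∃ λ l → (j : ℕ) →
    ∃ λ t → (j ≤ t) × (t + len ≤ j + l) × (factor y t len ≡ factor y i len)

InfiniteSet : (ℕ → Set) → Set
InfiniteSet P = (N : ℕ) → ∃ λ i → (N ≤ i) × P i

BoundedGaps : (ℕ → Set) → Set
BoundedGaps P = ∃ λ d → (i j : ℕ) → i < j → P i → P j →
  ((t : ℕ) → i < t → t < j → P t → Data.Empty.⊥) → j ∸ i ≤ d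
  where import Data.Empty

module Submission where

-- Since φ is k-uniform, x[i k^m, (i+1) k^m) = φ^m(x i), so x i ∼_m s says that this block of h(x) repeats
-- the prefix of length k^m. If ∼_m ⊆ ∼_m' then ∼_{m+1} ⊆ ∼_{m'+1}; by pigeonhole on the at most B_n
-- equivalence relations on A the sequence (∼_m) is periodic from B_n on, so for r ≥ B_n we have
-- ∼_r ⊆ ∼_M for arbitrarily large M. Hence if the positions i with x i ∼_r s have bounded gaps, every factor
-- of h(x) recurs inside the repeated prefix blocks.
-- Conversely, if h(x) is almost periodic, long prefixes recur with bounded gaps, and the residues mod k^r
-- at which arbitrarily long prefixes recur form a subgroup of ℤ/k^r; so every recurrence can be shifted
-- to one at a multiple i k^r, i.e. to a position i with x i ∼_r s. Thus for some l every φ^l(a) contains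
-- a letter ∼_r s, and the same periodicity argument applied to the sets {a | φ^m(a) contains such a
-- letter} shows that l = 2^n works, which gives bounded gaps.

open import Defs
open import Data.Bool using (Bool; true; false; T)
open import Data.Empty using (⊥; ⊥-elim)
open import Data.Fin using (Fin; fromℕ<; toℕ)
import Data.Fin.Properties as Fin
open import Data.List using (List; []; _∷_; [_]; length; concatMap; map; lookup; _++_; upTo; applyUpTo)
open import Data.List.Properties
  using (length-++; length-map; concatMap-++; length-upTo; map-upTo; ∷-injective; ≡-dec)
open import Data.List.Membership.Propositional using (_∈_)
open import Data.List.Membership.Propositional.Properties
  using (∈-++⁺ˡ; ∈-++⁺ʳ; ∈-map⁺; ∈-concatMap⁺; ∈-upTo⁺)
open import Data.List.Relation.Unary.Any using (here; index)
import Data.List.Relation.Unary.Any as Any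
open import Data.List.Relation.Unary.Any.Properties using (lookup-index)
open import Data.Nat
open import Data.Nat.DivMod
open import Data.Nat.Properties
open import Data.Product using (∃; ∃₂; _×_; _,_; proj₁; proj₂)
open import Data.Sum using (_⊎_; inj₁; inj₂)
open import Data.Vec using (Vec; []; _∷_)
import Data.Vec as Vec
open import Data.Vec.Properties using (lookup∘tabulate)
open import Effect.Monad using (RawMonad)
open import Function using (case_of_)
open import Function.Bundles using (_⇔_; mk⇔)
open import Level using (0ℓ)
open import Relation.Binary.Definitions using (Decidable)
open import Relation.Binary.PropositionalEquality hiding ([_])
open import Relation.Binary.Structures using (IsEquivalence)
open import Relation.Nullary using (¬_; Dec; yes; no; ¬¬-excluded-middle)
open import Relation.Nullary.Decidable using (isYes; fromWitness; toWitness; map′; decidable-stable)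
open import Relation.Nullary.Negation using (¬¬-Monad)

private
  variable
    A B : Set

nth : A → List A → ℕ → A
nth d []      i       = d
nth d (a ∷ w) zero    = a
nth d (a ∷ w) (suc i) = nth d w i

nth-irrelevant : ∀ (d d' : A) w {i} → i < length w → nth d w i ≡ nth d' w i
nth-irrelevant d d' (a ∷ w) {zero}  _         = refl
nth-irrelevant d d' (a ∷ w) {suc i} (s≤s i<n) = nth-irrelevant d d' w i<n

lookup≡nth : ∀ (d : A) w {i} (i<n : i < length w) → lookup w (fromℕ< i<n) ≡ nth d w i
lookup≡nth d (a ∷ w) {zero}  _         = refl
lookup≡nth d (a ∷ w) {suc i} (s≤s i<n) = lookup≡nth d w i<n

nth-map : ∀ (f : A → B) (d : A) w i → nth (f d) (map f w) i ≡ f (nth d w i)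
nth-map f d []      i       = refl
nth-map f d (a ∷ w) zero    = refl
nth-map f d (a ∷ w) (suc i) = nth-map f d w i

nth-++ˡ : ∀ (d : A) u v {i} → i < length u → nth d (u ++ v) i ≡ nth d u i
nth-++ˡ d (a ∷ u) v {zero}  _         = refl
nth-++ˡ d (a ∷ u) v {suc i} (s≤s i<n) = nth-++ˡ d u v i<n

nth-++ʳ : ∀ (d : A) u v i → nth d (u ++ v) (length u + i) ≡ nth d v i
nth-++ʳ d []      v i = refl
nth-++ʳ d (a ∷ u) v i = nth-++ʳ d u v i

nth-ext : ∀ (d : A) u v → length u ≡ length v → (∀ i → i < length u → nth d u i ≡ nth d v i) → u ≡ v
nth-ext d []      []      _  _  = refl
nth-ext d (a ∷ u) (b ∷ v) eq pt =
  cong₂ _∷_ (pt 0 z<s) (nth-ext d u v (suc-injective eq) (λ i i<n → pt (suc i) (s<s i<n)))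

module _ (f : A → List B) {L : ℕ} (length-f : ∀ a → length (f a) ≡ L) where

  length-concatMap-const : ∀ w → length (concatMap f w) ≡ length w * L
  length-concatMap-const []      = refl
  length-concatMap-const (a ∷ w) =
    trans (length-++ (f a)) (cong₂ _+_ (length-f a) (length-concatMap-const w))

  nth-concatMap-const : ∀ (d : B) (d' : A) w {j ρ} → j < length w → ρ < L →
    nth d (concatMap f w) (j * L + ρ) ≡ nth d (f (nth d' w j)) ρ
  nth-concatMap-const d d' (a ∷ w) {zero} {ρ} _ ρ<L =
    nth-++ˡ d (f a) (concatMap f w) (subst (ρ <_) (sym (length-f a)) ρ<L)
  nth-concatMap-const d d' (a ∷ w) {suc j} {ρ} (s≤s j<n) ρ<L = begin
    nth d (f a ++ concatMap f w) (L + j * L + ρ)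
      ≡⟨ cong (nth d (f a ++ concatMap f w))
           (trans (+-assoc L (j * L) ρ) (cong (_+ (j * L + ρ)) (sym (length-f a)))) ⟩
    nth d (f a ++ concatMap f w) (length (f a) + (j * L + ρ))
      ≡⟨ nth-++ʳ d (f a) (concatMap f w) (j * L + ρ) ⟩
    nth d (concatMap f w) (j * L + ρ)
      ≡⟨ nth-concatMap-const d d' w j<n ρ<L ⟩
    nth d (f (nth d' w j)) ρ ∎
    where open ≡-Reasoning

module _ (φ : Morphism A) where

  iter-[] : ∀ m → iter φ m [] ≡ []
  iter-[] zero    = refl
  iter-[] (suc m) = cong (apply φ) (iter-[] m)

  iter-++ : ∀ m u v → iter φ m (u ++ v) ≡ iter φ m u ++ iter φ m v
  iter-++ zero    u v = refl
  iter-++ (suc m) u v = trans (cong (apply φ) (iter-++ m u v)) (concatMap-++ φ (iter φ m u) (iter φ m v))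

  iter-letterwise : ∀ m w → iter φ m w ≡ concatMap (λ b → iter φ m [ b ]) w
  iter-letterwise m []      = iter-[] m
  iter-letterwise m (a ∷ w) = trans (iter-++ m [ a ] w) (cong (iter φ m [ a ] ++_) (iter-letterwise m w))

  iter-+ : ∀ m m' w → iter φ (m + m') w ≡ iter φ m (iter φ m' w)
  iter-+ zero    m' w = refl
  iter-+ (suc m) m' w = cong (apply φ) (iter-+ m m' w)

decompose-<* : ∀ c d .{{_ : NonZero d}} {J} → J < c * d → ∃₂ λ t ρ → t < c × ρ < d × J ≡ t * d + ρ
decompose-<* c d {J} J<cd =
  J / d , J % d , m<n*o⇒m/o<n J<cd , m%n<n J d , trans (m≡m%n+[m/n]*n J d) (+-comm (J % d) (J / d * d))

compose-<* : ∀ {c d t ρ} → t < c → ρ < d → t * d + ρ < c * d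
compose-<* {c} {d} {t} {ρ} t<c ρ<d = begin-strict
  t * d + ρ <⟨ +-monoʳ-< (t * d) ρ<d ⟩
  t * d + d ≡⟨ +-comm (t * d) d ⟩
  suc t * d ≤⟨ *-monoˡ-≤ d t<c ⟩
  c * d     ∎
  where open ≤-Reasoning

within-block : ∀ {a K i} → a * K ≤ i → i < a * K + K → ∃ λ j → j < K × i ≡ a * K + j
within-block {a} {K} {i} aK≤i i<aK+K =
  i ∸ a * K , +-cancelˡ-< (a * K) (i ∸ a * K) K (subst (_< a * K + K) (sym (m+[n∸m]≡n aK≤i)) i<aK+K) ,
  sym (m+[n∸m]≡n aK≤i)

n<m^n : ∀ {m} → 1 < m → ∀ n → n < m ^ n
n<m^n {m} 1<m zero    = z<s
n<m^n {m} 1<m (suc n) = begin-strict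
  suc n         ≤⟨ n<m^n 1<m n ⟩
  m ^ n         <⟨ m<m+n (m ^ n) (m^n>0 m n) ⟩
  m ^ n + m ^ n ≡⟨ cong (m ^ n +_) (sym (+-identityʳ (m ^ n))) ⟩
  2 * m ^ n     ≤⟨ *-monoˡ-≤ (m ^ n) 1<m ⟩
  m ^ suc n     ∎
  where
  open ≤-Reasoning
  instance
    m≢0 : NonZero m
    m≢0 = >-nonZero (<-trans z<s 1<m)

module Uniform-morphism (φ : Morphism A) {k : ℕ} (uniform : Uniform k φ) where

  length-iter : ∀ m w → length (iter φ m w) ≡ length w * k ^ m
  length-iter zero    w = sym (*-identityʳ (length w))
  length-iter (suc m) w = begin
    length (apply φ (iter φ m w)) ≡⟨ length-concatMap-const φ uniform (iter φ m w) ⟩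
    length (iter φ m w) * k       ≡⟨ cong (_* k) (length-iter m w) ⟩
    length w * k ^ m * k          ≡⟨ *-assoc (length w) (k ^ m) k ⟩
    length w * (k ^ m * k)        ≡⟨ cong (length w *_) (*-comm (k ^ m) k) ⟩
    length w * k ^ suc m          ∎
    where open ≡-Reasoning

  length-iter-[_] : ∀ a m → length (iter φ m [ a ]) ≡ k ^ m
  length-iter-[ a ] m = trans (length-iter m [ a ]) (+-identityʳ (k ^ m))

  <-length-iter-[_] : ∀ a m {j} → j < k ^ m → j < length (iter φ m [ a ])
  <-length-iter-[ a ] m = subst (_ <_) (sym (length-iter-[ a ] m))

  letter : A → ℕ → ℕ → A
  letter a m j = nth a (iter φ m [ a ]) j

  letter-+ : ∀ a m m' {j ρ} → j < k ^ m' → ρ < k ^ m →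
    letter a (m + m') (j * k ^ m + ρ) ≡ letter (letter a m' j) m ρ
  letter-+ a m m' {j} {ρ} j<k^m' ρ<k^m = begin
    nth a (iter φ (m + m') [ a ]) (j * k ^ m + ρ)
      ≡⟨ cong (λ w → nth a w (j * k ^ m + ρ))
           (trans (iter-+ φ m m' [ a ]) (iter-letterwise φ m (iter φ m' [ a ]))) ⟩
    nth a (concatMap (λ b → iter φ m [ b ]) (iter φ m' [ a ])) (j * k ^ m + ρ)
      ≡⟨ nth-concatMap-const (λ b → iter φ m [ b ]) (λ b → length-iter-[ b ] m) a a (iter φ m' [ a ])
           (<-length-iter-[ a ] m' j<k^m') ρ<k^m ⟩
    nth a (iter φ m [ letter a m' j ]) ρ
      ≡⟨ nth-irrelevant a (letter a m' j) (iter φ m [ letter a m' j ])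
           (<-length-iter-[ letter a m' j ] m ρ<k^m) ⟩
    letter (letter a m' j) m ρ ∎
    where open ≡-Reasoning

  letter-suc : ∀ a m {t ρ} → t < k → ρ < k ^ m →
    letter a (suc m) (t * k ^ m + ρ) ≡ letter (letter a 1 t) m ρ
  letter-suc a m {t} {ρ} t<k ρ<k^m =
    trans (cong (λ m' → letter a m' (t * k ^ m + ρ)) (+-comm 1 m))
          (letter-+ a m 1 (subst (t <_) (sym (*-identityʳ k)) t<k) ρ<k^m)

  prolongable⇒1<k : ∀ {s} → Prolongable φ s → 1 < k
  prolongable⇒1<k {s} (_ , unbounded) with m , 1<length ← unbounded 1 = ≰⇒> λ k≤1 →
    <-irrefl refl (<-≤-trans (subst (1 <_) (length-iter-[ s ] m) 1<length)
                             (subst (k ^ m ≤_) (^-zeroˡ m) (^-monoˡ-≤ m k≤1)))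

  module _ .{{_ : NonZero k}} where

    decompose-suc : ∀ m {J} → J < k ^ suc m → ∃₂ λ t ρ → t < k × ρ < k ^ m × J ≡ t * k ^ m + ρ
    decompose-suc m = decompose-<* k (k ^ m) {{m^n≢0 k m}}

    module _ {B : Set} (h : A → B) where

      Agree : ℕ → A → A → Set
      Agree m a b = ∀ j → j < k ^ m → h (letter a m j) ≡ h (letter b m j)

      Equiv⇒Agree : ∀ m {a b} → Equiv φ h m a b → Agree m a b
      Equiv⇒Agree m {a} {b} eq j j<k^m = begin
        h (nth a (iter φ m [ a ]) j)       ≡⟨ nth-map h a (iter φ m [ a ]) j ⟨
        nth (h a) (map h (iter φ m [ a ])) j ≡⟨ cong (λ w → nth (h a) w j) eq ⟩
        nth (h a) (map h (iter φ m [ b ])) j ≡⟨ nth-map h a (iter φ m [ b ]) j ⟩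
        h (nth a (iter φ m [ b ]) j)
          ≡⟨ cong h (nth-irrelevant a b (iter φ m [ b ]) (<-length-iter-[ b ] m j<k^m)) ⟩
        h (nth b (iter φ m [ b ]) j)       ∎
        where open ≡-Reasoning

      Agree⇒Equiv : ∀ m {a b} → Agree m a b → Equiv φ h m a b
      Agree⇒Equiv m {a} {b} agree = nth-ext (h a) _ _ equal-length λ j j<n →
        let j<k^m = subst (j <_) length-map-iter-[ a ] j<n in
        begin
          nth (h a) (map h (iter φ m [ a ])) j ≡⟨ nth-map h a (iter φ m [ a ]) j ⟩
          h (nth a (iter φ m [ a ]) j)         ≡⟨ agree j j<k^m ⟩
          h (nth b (iter φ m [ b ]) j)
            ≡⟨ cong h (nth-irrelevant b a (iter φ m [ b ]) (<-length-iter-[ b ] m j<k^m)) ⟩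
          h (nth a (iter φ m [ b ]) j)         ≡⟨ nth-map h a (iter φ m [ b ]) j ⟨
          nth (h a) (map h (iter φ m [ b ])) j ∎
        where
        open ≡-Reasoning
        length-map-iter-[_] : ∀ c → length (map h (iter φ m [ c ])) ≡ k ^ m
        length-map-iter-[ c ] = trans (length-map h (iter φ m [ c ])) (length-iter-[ c ] m)
        equal-length : length (map h (iter φ m [ a ])) ≡ length (map h (iter φ m [ b ]))
        equal-length = trans length-map-iter-[ a ] (sym length-map-iter-[ b ])

      Agree-suc⁺ : ∀ m {a b} → (∀ t → t < k → Agree m (letter a 1 t) (letter b 1 t)) → Agree (suc m) a b
      Agree-suc⁺ m {a} {b} agree J J<k^m+1 with decompose-suc m J<k^m+1
      ... | t , ρ , t<k , ρ<k^m , refl = begin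
        h (letter a (suc m) (t * k ^ m + ρ)) ≡⟨ cong h (letter-suc a m t<k ρ<k^m) ⟩
        h (letter (letter a 1 t) m ρ)        ≡⟨ agree t t<k ρ ρ<k^m ⟩
        h (letter (letter b 1 t) m ρ)        ≡⟨ cong h (letter-suc b m t<k ρ<k^m) ⟨
        h (letter b (suc m) (t * k ^ m + ρ)) ∎
        where open ≡-Reasoning

      Agree-suc⁻ : ∀ m {a b} → Agree (suc m) a b → ∀ t → t < k → Agree m (letter a 1 t) (letter b 1 t)
      Agree-suc⁻ m {a} {b} agree t t<k ρ ρ<k^m = begin
        h (letter (letter a 1 t) m ρ)        ≡⟨ cong h (letter-suc a m t<k ρ<k^m) ⟨
        h (letter a (suc m) (t * k ^ m + ρ)) ≡⟨ agree _ (compose-<* t<k ρ<k^m) ⟩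
        h (letter b (suc m) (t * k ^ m + ρ)) ≡⟨ cong h (letter-suc b m t<k ρ<k^m) ⟩
        h (letter (letter b 1 t) m ρ)        ∎
        where open ≡-Reasoning

      Equiv⊆ : ℕ → ℕ → Set
      Equiv⊆ m m' = ∀ a b → Equiv φ h m a b → Equiv φ h m' a b

      Equiv⊆-suc : ∀ {m m'} → Equiv⊆ m m' → Equiv⊆ (suc m) (suc m')
      Equiv⊆-suc {m} {m'} m⊆m' a b eq = Agree⇒Equiv (suc m') (Agree-suc⁺ m' λ t t<k →
        Equiv⇒Agree m' (m⊆m' _ _ (Agree⇒Equiv m (Agree-suc⁻ m (Equiv⇒Agree (suc m) eq) t t<k))))

    module _ (Q : A → Set) where

      Contains : ℕ → A → Set
      Contains m a = ∃ λ j → j < k ^ m × Q (letter a m j)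

      Contains-suc⁺ : ∀ {m a t} → t < k → Contains m (letter a 1 t) → Contains (suc m) a
      Contains-suc⁺ {m} {a} {t} t<k (ρ , ρ<k^m , q) =
        t * k ^ m + ρ , compose-<* t<k ρ<k^m , subst Q (sym (letter-suc a m t<k ρ<k^m)) q

      Contains-suc⁻ : ∀ {m a} → Contains (suc m) a → ∃ λ t → t < k × Contains m (letter a 1 t)
      Contains-suc⁻ {m} {a} (J , J<k^m+1 , q) with decompose-suc m J<k^m+1
      ... | t , ρ , t<k , ρ<k^m , refl = t , t<k , ρ , ρ<k^m , subst Q (letter-suc a m t<k ρ<k^m) q

      Contains⊆ : ℕ → ℕ → Set
      Contains⊆ m m' = ∀ a → Contains m a → Contains m' a

      Contains⊆-suc : ∀ {m m'} → Contains⊆ m m' → Contains⊆ (suc m) (suc m')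
      Contains⊆-suc {m} {m'} m⊆m' a c with Contains-suc⁻ {m} c
      ... | t , t<k , c' = Contains-suc⁺ {m'} t<k (m⊆m' _ c')

      Contains-everywhere-suc : ∀ {m} → (∀ a → Contains m a) → ∀ a → Contains (suc m) a
      Contains-everywhere-suc {m} everywhere a = Contains-suc⁺ {m} {a} (>-nonZero⁻¹ k) (everywhere (letter a 1 0))

module Fixed-point (φ : Morphism A) {k : ℕ} (uniform : Uniform k φ) (1<k : 1 < k)
                   {s : A} {x : ℕ → A} (limit : IsLimit φ s x) where

  open Uniform-morphism φ uniform

  x-prefix : ∀ m {i} → i < k ^ m → x i ≡ letter s m i
  x-prefix m {i} i<k^m = trans (limit m i i<length) (lookup≡nth s (iter φ m [ s ]) i<length)
    where i<length = <-length-iter-[ s ] m i<k^m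

  x-block : ∀ m i {j} → j < k ^ m → x (i * k ^ m + j) ≡ letter (x i) m j
  x-block m i {j} j<k^m = begin
    x (i * k ^ m + j)              ≡⟨ x-prefix (m + i) inside-prefix ⟩
    letter s (m + i) (i * k ^ m + j) ≡⟨ letter-+ s m i i<k^i j<k^m ⟩
    letter (letter s i i) m j      ≡⟨ cong (λ a → letter a m j) (x-prefix i i<k^i) ⟨
    letter (x i) m j               ∎
    where
    open ≡-Reasoning
    i<k^i : i < k ^ i
    i<k^i = n<m^n 1<k i
    inside-prefix : i * k ^ m + j < k ^ (m + i)
    inside-prefix = subst (i * k ^ m + j <_)
      (trans (*-comm (k ^ i) (k ^ m)) (sym (^-distribˡ-+-* k m i))) (compose-<* i<k^i j<k^m)

early-collision : ∀ {C : Set} (codes : List C) (code : ℕ → C) → (∀ m → code m ∈ codes) →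
  ∃₂ λ a b → a < b × b ≤ length codes × code a ≡ code b
early-collision codes code code∈codes
  with i , j , i<j , same-index ← Fin.pigeonhole (n<1+n (length codes)) (λ i → index (code∈codes (toℕ i)))
  = toℕ i , toℕ j , i<j , Fin.toℕ≤pred[n] j ,
    trans (lookup-index (code∈codes (toℕ i)))
      (trans (cong (lookup codes) same-index) (sym (lookup-index (code∈codes (toℕ j)))))

module Shift-compatible (R : ℕ → ℕ → Set) (R-refl : ∀ {a} → R a a)
                        (R-trans : ∀ {a b c} → R a b → R b c → R a c)
                        (R-suc : ∀ {a b} → R a b → R (suc a) (suc b)) where

  R-+ : ∀ t {a b} → R a b → R (t + a) (t + b)
  R-+ zero    r = r
  R-+ (suc t) r = R-suc (R-+ t r)

  R-periodic : ∀ {a b} → a ≤ b → R a b → R b a → ∀ {m} → a ≤ m → ∀ j →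
    R m (m + j * (b ∸ a)) × R (m + j * (b ∸ a)) m
  R-periodic {a} {b} a≤b Rab Rba {m} a≤m zero =
    subst (R m) (sym (+-identityʳ m)) R-refl , subst (λ n → R n m) (sym (+-identityʳ m)) R-refl
  R-periodic {a} {b} a≤b Rab Rba {m} a≤m (suc j)
    with forth , back ← R-periodic a≤b Rab Rba a≤m j =
    subst (R m) next (R-trans forth (proj₁ step)) , subst (λ n → R n m) next (R-trans (proj₂ step) back)
    where
    p = b ∸ a
    n = m + j * p
    next : n + p ≡ m + suc j * p
    next = trans (+-assoc m (j * p) p) (cong (m +_) (+-comm (j * p) p))
    a≤n : a ≤ n
    a≤n = ≤-trans a≤m (m≤m+n m (j * p))
    start : n ∸ a + a ≡ n
    start = m∸n+n≡m a≤n
    end : n ∸ a + b ≡ n + p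
    end = begin
      n ∸ a + b       ≡⟨ cong (n ∸ a +_) (m+[n∸m]≡n a≤b) ⟨
      n ∸ a + (a + p) ≡⟨ +-assoc (n ∸ a) a p ⟨
      n ∸ a + a + p   ≡⟨ cong (_+ p) start ⟩
      n + p           ∎
      where open ≡-Reasoning
    step : R n (n + p) × R (n + p) n
    step = subst₂ R start end (R-+ (n ∸ a) Rab) , subst₂ R end start (R-+ (n ∸ a) Rba)

  eventually-periodic : ∀ {C : Set} (code : ℕ → C) (codes : List C) → (∀ m → code m ∈ codes) →
    (∀ {a b} → code a ≡ code b → R a b) →
    ∃ λ p → 0 < p × ∀ {m} → length codes ≤ m → ∀ j → R m (m + j * p) × R (m + j * p) m
  eventually-periodic code codes code∈codes same-code⇒R
    with a , b , a<b , b≤length , same ← early-collision codes code code∈codes =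
    b ∸ a , m<n⇒0<n∸m a<b ,
    λ length≤m → R-periodic (<⇒≤ a<b) (same-code⇒R same) (same-code⇒R (sym same))
                            (≤-trans (<⇒≤ (<-≤-trans a<b b≤length)) length≤m)

-- Restricted growth strings, read from the right, of partitions into j blocks. The two parts of the
-- recursion are the two summands of S(n+1, j+1) = (j+1) S(n, j+1) + S(n, j): the new point joins one of
-- the j+1 blocks, or opens block j.
labellings : (n j : ℕ) → List (Vec ℕ n)
labellings zero    zero    = [ [] ]
labellings zero    (suc j) = []
labellings (suc n) zero    = []
labellings (suc n) (suc j) =
  concatMap (λ c → map (_∷ c) (upTo (suc j))) (labellings n (suc j)) ++ map (j ∷_) (labellings n j)

length-labellings : ∀ n j → length (labellings n j) ≡ stirling2 n j
length-labellings zero    zero    = refl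
length-labellings zero    (suc j) = refl
length-labellings (suc n) zero    = refl
length-labellings (suc n) (suc j) = begin
  length (joined ++ map (j ∷_) (labellings n j))
    ≡⟨ length-++ joined ⟩
  length joined + length (map (j ∷_) (labellings n j))
    ≡⟨ cong₂ _+_ length-joined (length-map (j ∷_) (labellings n j)) ⟩
  length (labellings n (suc j)) * suc j + length (labellings n j)
    ≡⟨ cong₂ _+_ (cong (_* suc j) (length-labellings n (suc j))) (length-labellings n j) ⟩
  stirling2 n (suc j) * suc j + stirling2 n j
    ≡⟨ cong (_+ stirling2 n j) (*-comm (stirling2 n (suc j)) (suc j)) ⟩
  suc j * stirling2 n (suc j) + stirling2 n j ∎
  where
  open ≡-Reasoning
  joined = concatMap (λ c → map (_∷ c) (upTo (suc j))) (labellings n (suc j))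
  length-joined : length joined ≡ length (labellings n (suc j)) * suc j
  length-joined = length-concatMap-const (λ c → map (_∷ c) (upTo (suc j)))
    (λ c → trans (length-map (_∷ c) (upTo (suc j))) (length-upTo (suc j))) (labellings n (suc j))

labellings≤ : (n J : ℕ) → List (Vec ℕ n)
labellings≤ n zero    = labellings n zero
labellings≤ n (suc J) = labellings≤ n J ++ labellings n (suc J)

length-labellings≤ : ∀ n J → length (labellings≤ n J) ≡ sumTo (stirling2 n) J
length-labellings≤ n zero    = length-labellings n zero
length-labellings≤ n (suc J) =
  trans (length-++ (labellings≤ n J)) (cong₂ _+_ (length-labellings≤ n J) (length-labellings n (suc J)))

∈-labellings≤ : ∀ {n J j c} → j ≤ J → c ∈ labellings n j → c ∈ labellings≤ n J
∈-labellings≤ {J = zero}  z≤n c∈ = c∈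
∈-labellings≤ {J = suc J} j≤J c∈ with m≤n⇒m<n∨m≡n j≤J
... | inj₁ j<J  = ∈-++⁺ˡ (∈-labellings≤ (s≤s⁻¹ j<J) c∈)
... | inj₂ refl = ∈-++⁺ʳ (labellings≤ _ J) c∈

record Labelling {n : ℕ} (R : Fin n → Fin n → Set) : Set where
  field
    blocks       : ℕ
    labels       : Vec ℕ n
    labels∈      : labels ∈ labellings n blocks
    blocks≤n     : blocks ≤ n
    label<blocks : ∀ a → Vec.lookup labels a < blocks
    sound        : ∀ {a b} → R a b → Vec.lookup labels a ≡ Vec.lookup labels b
    complete     : ∀ {a b} → Vec.lookup labels a ≡ Vec.lookup labels b → R a b

same-labels⇒⊆ : ∀ {n} {R R' : Fin n → Fin n → Set} (L : Labelling R) (L' : Labelling R') →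
  Labelling.labels L ≡ Labelling.labels L' → ∀ {a b} → R a b → R' a b
same-labels⇒⊆ L L' same r =
  Labelling.complete L' (subst (λ c → Vec.lookup c _ ≡ Vec.lookup c _) same (Labelling.sound L r))

module _ {n} {R : Fin (suc n) → Fin (suc n) → Set} (R-equiv : IsEquivalence R)
         (L : Labelling (λ a b → R (Fin.suc a) (Fin.suc b))) where

  open IsEquivalence R-equiv renaming (refl to R-refl; sym to R-sym; trans to R-trans)
  open Labelling L

  labelling-join : ∀ b → R Fin.zero (Fin.suc b) → Labelling R
  labelling-join b R0b = record
    { blocks = blocks ; labels = ℓ ∷ labels ; labels∈ = labels∈′ ; blocks≤n = m≤n⇒m≤1+n blocks≤n
    ; label<blocks = λ { Fin.zero → label<blocks b ; (Fin.suc a) → label<blocks a }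
    ; sound = sound′ ; complete = complete′ }
    where
    ℓ = Vec.lookup labels b
    labels∈′ : (ℓ ∷ labels) ∈ labellings (suc n) blocks
    labels∈′ with blocks | labels∈ | label<blocks b
    ... | suc j | c∈ | ℓ<1+j = ∈-++⁺ˡ (∈-concatMap⁺ (λ c → map (_∷ c) (upTo (suc j)))
                                 (Any.map (λ { refl → ∈-map⁺ (_∷ labels) (∈-upTo⁺ ℓ<1+j) }) c∈))
    sound′ : ∀ {a a'} → R a a' → Vec.lookup (ℓ ∷ labels) a ≡ Vec.lookup (ℓ ∷ labels) a'
    sound′ {Fin.zero}  {Fin.zero}   r = refl
    sound′ {Fin.zero}  {Fin.suc a'} r = sound (R-trans (R-sym R0b) r)
    sound′ {Fin.suc a} {Fin.zero}   r = sound (R-trans r R0b)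
    sound′ {Fin.suc a} {Fin.suc a'} r = sound r
    complete′ : ∀ {a a'} → Vec.lookup (ℓ ∷ labels) a ≡ Vec.lookup (ℓ ∷ labels) a' → R a a'
    complete′ {Fin.zero}  {Fin.zero}   e = R-refl
    complete′ {Fin.zero}  {Fin.suc a'} e = R-trans R0b (complete e)
    complete′ {Fin.suc a} {Fin.zero}   e = R-trans (complete e) (R-sym R0b)
    complete′ {Fin.suc a} {Fin.suc a'} e = complete e

  labelling-new : (∀ b → ¬ R Fin.zero (Fin.suc b)) → Labelling R
  labelling-new ¬R0b = record
    { blocks = suc blocks ; labels = blocks ∷ labels ; labels∈ = ∈-++⁺ʳ _ (∈-map⁺ (blocks ∷_) labels∈)
    ; blocks≤n = s≤s blocks≤n
    ; label<blocks = λ { Fin.zero → ≤-refl ; (Fin.suc a) → m≤n⇒m≤1+n (label<blocks a) }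
    ; sound = sound′ ; complete = complete′ }
    where
    sound′ : ∀ {a a'} → R a a' → Vec.lookup (blocks ∷ labels) a ≡ Vec.lookup (blocks ∷ labels) a'
    sound′ {Fin.zero}  {Fin.zero}   r = refl
    sound′ {Fin.zero}  {Fin.suc a'} r = ⊥-elim (¬R0b a' r)
    sound′ {Fin.suc a} {Fin.zero}   r = ⊥-elim (¬R0b a (R-sym r))
    sound′ {Fin.suc a} {Fin.suc a'} r = sound r
    complete′ : ∀ {a a'} → Vec.lookup (blocks ∷ labels) a ≡ Vec.lookup (blocks ∷ labels) a' → R a a'
    complete′ {Fin.zero}  {Fin.zero}   e = R-refl
    complete′ {Fin.zero}  {Fin.suc a'} e = ⊥-elim (<-irrefl (sym e) (label<blocks a'))
    complete′ {Fin.suc a} {Fin.zero}   e = ⊥-elim (<-irrefl e (label<blocks a))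
    complete′ {Fin.suc a} {Fin.suc a'} e = complete e

labelling : ∀ {n} {R : Fin n → Fin n → Set} → Decidable R → IsEquivalence R → Labelling R
labelling {zero} R? R-equiv = record
  { blocks = 0 ; labels = [] ; labels∈ = here refl ; blocks≤n = z≤n ; label<blocks = λ ()
  ; sound = λ { {()} } ; complete = λ { {()} } }
labelling {suc n} {R} R? R-equiv with Fin.any? (λ b → R? Fin.zero (Fin.suc b))
... | yes (b , R0b) = labelling-join R-equiv restricted b R0b
  where restricted = labelling (λ a b → R? (Fin.suc a) (Fin.suc b)) record { IsEquivalence R-equiv }
... | no ¬∃R0b      = labelling-new R-equiv restricted (λ b R0b → ¬∃R0b (b , R0b))
  where restricted = labelling (λ a b → R? (Fin.suc a) (Fin.suc b)) record { IsEquivalence R-equiv }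

allBoolVecs : ∀ n → List (Vec Bool n)
allBoolVecs zero    = [ [] ]
allBoolVecs (suc n) = map (true ∷_) (allBoolVecs n) ++ map (false ∷_) (allBoolVecs n)

∈-allBoolVecs : ∀ {n} (v : Vec Bool n) → v ∈ allBoolVecs n
∈-allBoolVecs []          = here refl
∈-allBoolVecs (true ∷ v)  = ∈-++⁺ˡ (∈-map⁺ (true ∷_) (∈-allBoolVecs v))
∈-allBoolVecs (false ∷ v) = ∈-++⁺ʳ _ (∈-map⁺ (false ∷_) (∈-allBoolVecs v))

characteristic : ∀ {n} {P : Fin n → Set} → (∀ a → Dec (P a)) → Vec Bool n
characteristic P? = Vec.tabulate (λ a → isYes (P? a))

same-characteristic⇒⊆ : ∀ {n} {P P' : Fin n → Set} (P? : ∀ a → Dec (P a)) (P'? : ∀ a → Dec (P' a)) →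
  characteristic P? ≡ characteristic P'? → ∀ {a} → P a → P' a
same-characteristic⇒⊆ P? P'? same {a} Pa = toWitness {a? = P'? a} (subst T same-bit (fromWitness {a? = P? a} Pa))
  where
  same-bit : isYes (P? a) ≡ isYes (P'? a)
  same-bit = trans (sym (lookup∘tabulate _ a)) (trans (cong (λ v → Vec.lookup v a) same) (lookup∘tabulate _ a))

Syndetic : (ℕ → Set) → Set
Syndetic P = ∃ λ D → ∀ N → ∃ λ t → N ≤ t × t ≤ N + D × P t

module _ {P : ℕ → Set} where

  syndetic-mono : ∀ {P' : ℕ → Set} → (∀ {t} → P t → P' t) → Syndetic P → Syndetic P'
  syndetic-mono P⊆P' (D , hit) = D , λ N → let t , N≤t , t≤N+D , Pt = hit N in t , N≤t , t≤N+D , P⊆P' Pt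

  syndetic⇒infinite : Syndetic P → InfiniteSet P
  syndetic⇒infinite (D , hit) N with t , N≤t , _ , Pt ← hit N = t , N≤t , Pt

  syndetic⇒boundedGaps : Syndetic P → BoundedGaps P
  syndetic⇒boundedGaps (D , hit) = suc D , gap
    where
    gap : ∀ i j → i < j → P i → P j → (∀ t → i < t → t < j → P t → ⊥) → j ∸ i ≤ suc D
    gap i j i<j Pi Pj none with t , i<t , t≤1+i+D , Pt ← hit (suc i) =
      m≤n+o⇒m∸n≤o j i (≤-trans j≤t (subst (t ≤_) (sym (+-suc i D)) t≤1+i+D))
      where
      j≤t : j ≤ t
      j≤t = ≮⇒≥ (λ t<j → none t i<t t<j Pt)

  blocks⇒syndetic : ∀ K .{{_ : NonZero K}} → (∀ i → ∃ λ j → j < K × P (i * K + j)) → Syndetic P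
  blocks⇒syndetic K hit-block = K + K , λ N →
    let i = suc (N / K) ; j , j<K , Pij = hit-block i in
    i * K + j , ≤-trans (<⇒≤ (N<iK N)) (m≤m+n (i * K) j) , iK+j≤ N j<K , Pij
    where
    open ≤-Reasoning
    N<iK : ∀ N → N < suc (N / K) * K
    N<iK N = begin-strict
      N                 ≡⟨ m≡m%n+[m/n]*n N K ⟩
      N % K + N / K * K <⟨ +-monoˡ-< (N / K * K) (m%n<n N K) ⟩
      suc (N / K) * K   ∎
    iK+j≤ : ∀ N {j} → j < K → suc (N / K) * K + j ≤ N + (K + K)
    iK+j≤ N {j} j<K = begin
      K + N / K * K + j   ≤⟨ +-mono-≤ (+-monoʳ-≤ K (m/n*n≤m N K)) (<⇒≤ j<K) ⟩
      K + N + K           ≡⟨ cong (_+ K) (+-comm K N) ⟩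
      N + K + K           ≡⟨ +-assoc N K K ⟩
      N + (K + K)         ∎

module _ {P : ℕ → Set} (P? : ∀ n → Dec (P n)) where

  least-≥ : ∀ N len → P (N + len) → ∃ λ t → N ≤ t × P t × (∀ u → N ≤ u → u < t → ¬ P u)
  least-≥ N len P[N+len] with P? N
  ... | yes PN = N , ≤-refl , PN , λ u N≤u u<N _ → <-irrefl refl (≤-<-trans N≤u u<N)
  least-≥ N zero    P[N+0] | no ¬PN = ⊥-elim (¬PN (subst P (+-identityʳ N) P[N+0]))
  least-≥ N (suc len) P[N+1+len] | no ¬PN
    with t , N<t , Pt , below ← least-≥ (suc N) len (subst P (+-suc N len) P[N+1+len]) =
    t , <⇒≤ N<t , Pt , λ u N≤u u<t Pu → case m≤n⇒m<n∨m≡n N≤u of λ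
      { (inj₁ N<u) → below u N<u u<t Pu
      ; (inj₂ refl) → ¬PN Pu }

  greatest-< : ∀ {e N} → e < N → P e → ∃ λ p → p < N × P p × (∀ u → p < u → u < N → ¬ P u)
  greatest-< {e} {suc N} e<1+N Pe with P? N
  ... | yes PN = N , ≤-refl , PN , λ u N<u u<1+N _ → <-irrefl refl (<-≤-trans N<u (s≤s⁻¹ u<1+N))
  ... | no ¬PN with m≤n⇒m<n∨m≡n (s≤s⁻¹ e<1+N)
  ...   | inj₂ refl = ⊥-elim (¬PN Pe)
  ...   | inj₁ e<N with p , p<N , Pp , above ← greatest-< e<N Pe =
    p , m≤n⇒m≤1+n p<N , Pp , λ u p<u u<1+N Pu → case m≤n⇒m<n∨m≡n (s≤s⁻¹ u<1+N) of λ
      { (inj₁ u<N) → above u p<u u<N Pu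
      ; (inj₂ refl) → ¬PN Pu }

  -- t is the first element ≥ N; if some element lies below N, then the last one, p, and t are consecutive.
  infinite∧boundedGaps⇒syndetic : InfiniteSet P → BoundedGaps P → Syndetic P
  infinite∧boundedGaps⇒syndetic infinite (d , gap) = d + e , λ N → within N (infinite N)
    where
    e = proj₁ (infinite 0)
    Pe = proj₂ (proj₂ (infinite 0))
    within : ∀ N → (∃ λ q → N ≤ q × P q) → ∃ λ t → N ≤ t × t ≤ N + (d + e) × P t
    within N (q , N≤q , Pq)
      with t , N≤t , Pt , below ← least-≥ N (q ∸ N) (subst P (sym (m+[n∸m]≡n N≤q)) Pq)
      with e <? N
    ... | no e≮N =
      t , N≤t , ≤-trans (≮⇒≥ (λ e<t → below e (≮⇒≥ e≮N) e<t Pe)) (≤-trans (m≤n+m e d) (m≤n+m (d + e) N)) , Pt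
    ... | yes e<N with p , p<N , Pp , above ← greatest-< e<N Pe = t , N≤t , t≤N+d+e , Pt
      where
      consecutive : ∀ u → p < u → u < t → P u → ⊥
      consecutive u p<u u<t Pu with u <? N
      ... | yes u<N = above u p<u u<N Pu
      ... | no u≮N  = below u (≮⇒≥ u≮N) u<t Pu
      t≤N+d+e : t ≤ N + (d + e)
      t≤N+d+e = begin
        t           ≡⟨ m+[n∸m]≡n (<⇒≤ (<-≤-trans p<N N≤t)) ⟨
        p + (t ∸ p) ≤⟨ +-mono-≤ (<⇒≤ p<N) (gap p t (<-≤-trans p<N N≤t) Pp Pt consecutive) ⟩
        N + d       ≤⟨ +-monoʳ-≤ N (m≤m+n d e) ⟩
        N + (d + e) ∎
        where open ≤-Reasoning

applyUpTo-cong : ∀ {f g : ℕ → A} n → (∀ u → u < n → f u ≡ g u) → applyUpTo f n ≡ applyUpTo g n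
applyUpTo-cong zero    f≡g = refl
applyUpTo-cong (suc n) f≡g = cong₂ _∷_ (f≡g 0 z<s) (applyUpTo-cong n (λ u u<n → f≡g (suc u) (s<s u<n)))

applyUpTo-injective : ∀ {f g : ℕ → A} n → applyUpTo f n ≡ applyUpTo g n → ∀ u → u < n → f u ≡ g u
applyUpTo-injective (suc n) eq zero    _         = proj₁ (∷-injective eq)
applyUpTo-injective (suc n) eq (suc u) (s<s u<n) = applyUpTo-injective n (proj₂ (∷-injective eq)) u u<n

module _ (y : ℕ → B) where

  factor-≡ : ∀ t i len → (∀ u → u < len → y (t + u) ≡ y (i + u)) → factor y t len ≡ factor y i len
  factor-≡ t i len agree =
    trans (map-upTo _ len) (trans (applyUpTo-cong len agree) (sym (map-upTo _ len)))

  factor-≡⁻ : ∀ t i len → factor y t len ≡ factor y i len → ∀ u → u < len → y (t + u) ≡ y (i + u)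
  factor-≡⁻ t i len eq = applyUpTo-injective len (trans (sym (map-upTo _ len)) (trans eq (map-upTo _ len)))

  PrefixAt : ℕ → ℕ → Set
  PrefixAt N t = ∀ u → u < N → y (t + u) ≡ y u

  PrefixAt-≤ : ∀ {N N' t} → N' ≤ N → PrefixAt N t → PrefixAt N' t
  PrefixAt-≤ N'≤N prefix u u<N' = prefix u (<-≤-trans u<N' N'≤N)

  PrefixAt-+ : ∀ {N t₁ t₂} → PrefixAt (t₁ + N) t₂ → PrefixAt N t₁ → PrefixAt N (t₂ + t₁)
  PrefixAt-+ {N} {t₁} {t₂} prefix₂ prefix₁ u u<N =
    trans (cong y (+-assoc t₂ t₁ u)) (trans (prefix₂ (t₁ + u) (+-monoʳ-< t₁ u<N)) (prefix₁ u u<N))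

  AlignedPrefixRecurs : ℕ → ℕ → Set
  AlignedPrefixRecurs Q l = ∀ j → ∃ λ i → j ≤ i * Q × i * Q + Q ≤ j + l × PrefixAt Q (i * Q)

  RecurrentFactor : ℕ → ℕ → Set
  RecurrentFactor i len = ∃ λ l → (j : ℕ) →
    ∃ λ t → (j ≤ t) × (t + len ≤ j + l) × (factor y t len ≡ factor y i len)

  syndetic-copies⇒recurrent : ∀ K .{{_ : NonZero K}} {P : ℕ → Set} → Syndetic P →
    (∀ t → P t → PrefixAt K (t * K)) → ∀ i len → i + len ≤ K → RecurrentFactor i len
  syndetic-copies⇒recurrent K (D , hit) copy i len i+len≤K = K + D * K + K , λ j →
    let t , N≤t , t≤N+D , Pt = hit (suc (j / K)) in
    t * K + i , lower j N≤t , upper j t≤N+D ,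
    factor-≡ (t * K + i) i len λ u u<len →
      trans (cong y (+-assoc (t * K) i u)) (copy t Pt (i + u) (<-≤-trans (+-monoʳ-< i u<len) i+len≤K))
    where
    open ≤-Reasoning
    lower : ∀ j {t} → suc (j / K) ≤ t → j ≤ t * K + i
    lower j {t} N≤t = begin
      j                 ≡⟨ m≡m%n+[m/n]*n j K ⟩
      j % K + j / K * K ≤⟨ +-monoˡ-≤ (j / K * K) (<⇒≤ (m%n<n j K)) ⟩
      suc (j / K) * K   ≤⟨ *-monoˡ-≤ K N≤t ⟩
      t * K             ≤⟨ m≤m+n (t * K) i ⟩
      t * K + i         ∎
    upper : ∀ j {t} → t ≤ suc (j / K) + D → t * K + i + len ≤ j + (K + D * K + K)
    upper j {t} t≤N+D = begin
      t * K + i + len                ≡⟨ +-assoc (t * K) i len ⟩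
      t * K + (i + len)              ≤⟨ +-monoʳ-≤ (t * K) i+len≤K ⟩
      t * K + K                      ≤⟨ +-monoˡ-≤ K (*-monoˡ-≤ K t≤N+D) ⟩
      (suc (j / K) + D) * K + K      ≡⟨ cong (_+ K) (*-distribʳ-+ K (suc (j / K)) D) ⟩
      K + j / K * K + D * K + K      ≤⟨ +-monoˡ-≤ K (+-monoˡ-≤ (D * K) (+-monoʳ-≤ K (m/n*n≤m j K))) ⟩
      K + j + D * K + K              ≡⟨ cong (λ n → n + D * K + K) (+-comm K j) ⟩
      j + K + D * K + K              ≡⟨ cong (_+ K) (+-assoc j K (D * K)) ⟩
      j + (K + D * K) + K            ≡⟨ +-assoc j (K + D * K) K ⟩
      j + (K + D * K + K)            ∎

module Aligned-prefixes (y : ℕ → B) (Q : ℕ) .{{_ : NonZero Q}} where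

  open RawMonad (¬¬-Monad {0ℓ})

  -- Recurrent residues form a submonoid, hence a subgroup, of ℤ/Q; this is what lets `align` move an
  -- occurrence of a long prefix forward to a multiple of Q.
  Recurrent : ℕ → Set
  Recurrent c = ∀ N → ¬ ¬ ∃ λ t → t % Q ≡ c % Q × PrefixAt y N t

  recurrent-0 : Recurrent 0
  recurrent-0 N = pure (0 , refl , λ u _ → refl)

  recurrent-+ : ∀ {a b} → Recurrent a → Recurrent b → Recurrent (a + b)
  recurrent-+ {a} {b} recurrent-a recurrent-b N = do
    t₁ , t₁≡a , prefix₁ ← recurrent-a N
    t₂ , t₂≡b , prefix₂ ← recurrent-b (t₁ + N)
    pure (t₂ + t₁ , residue t₁≡a t₂≡b , PrefixAt-+ y prefix₂ prefix₁)
    where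
    residue : ∀ {t₁ t₂} → t₁ % Q ≡ a % Q → t₂ % Q ≡ b % Q → (t₂ + t₁) % Q ≡ (a + b) % Q
    residue {t₁} {t₂} t₁≡a t₂≡b = begin
      (t₂ + t₁) % Q           ≡⟨ %-distribˡ-+ t₂ t₁ Q ⟩
      (t₂ % Q + t₁ % Q) % Q   ≡⟨ cong₂ (λ u v → (u + v) % Q) t₂≡b t₁≡a ⟩
      (b % Q + a % Q) % Q     ≡⟨ %-distribˡ-+ b a Q ⟨
      (b + a) % Q             ≡⟨ cong (_% Q) (+-comm b a) ⟩
      (a + b) % Q             ∎
      where open ≡-Reasoning

  recurrent-* : ∀ {c} m → Recurrent c → Recurrent (m * c)
  recurrent-* zero    recurrent = recurrent-0
  recurrent-* (suc m) recurrent = recurrent-+ recurrent (recurrent-* m recurrent)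

  recurrent-% : ∀ {c} → Recurrent c → Recurrent (c % Q)
  recurrent-% {c} recurrent N = do
    t , t≡c , prefix ← recurrent N
    pure (t , trans t≡c (sym (m%n%n≡m%n c Q)) , prefix)

  -- Classically every residue is settled by some bound, so finitely many residues share one bound; this is
  -- the only non-constructive step, and it is discharged at the end because the conclusion is decidable.
  Settled : ℕ → ℕ → Set
  Settled c B = (¬ ∃ λ t → t % Q ≡ c % Q × PrefixAt y B t)
              ⊎ (Recurrent c × ∃ λ o → o % Q ≡ c % Q × o ≤ B × PrefixAt y Q o)

  settled-mono : ∀ {c B B'} → B ≤ B' → Settled c B → Settled c B'
  settled-mono B≤B' (inj₁ none) = inj₁ λ (t , t≡c , prefix) → none (t , t≡c , PrefixAt-≤ y B≤B' prefix)
  settled-mono B≤B' (inj₂ (recurrent , o , o≡c , o≤B , prefix)) =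
    inj₂ (recurrent , o , o≡c , ≤-trans o≤B B≤B' , prefix)

  ¬¬settled : ∀ c → ¬ ¬ ∃ (Settled c)
  ¬¬settled c = do
    bounded? ← ¬¬-excluded-middle {A = ∃ λ N → ¬ ∃ λ t → t % Q ≡ c % Q × PrefixAt y N t}
    case bounded? of λ
      { (yes (N , none)) → pure (N , inj₁ none)
      ; (no unbounded) → do
          let recurrent : Recurrent c
              recurrent N none = unbounded (N , none)
          o , o≡c , prefix ← recurrent Q
          pure (o , inj₂ (recurrent , o , o≡c , ≤-refl , prefix)) }

  ¬¬all-settled : ∀ m → ¬ ¬ ∃ λ B → ∀ c → c < m → Settled c B
  ¬¬all-settled zero    = pure (0 , λ _ ())
  ¬¬all-settled (suc m) = do
    B₁ , settled₁ ← ¬¬all-settled m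
    B₂ , settled₂ ← ¬¬settled m
    pure (B₁ ⊔ B₂ , λ c c<1+m → case m≤n⇒m<n∨m≡n (s≤s⁻¹ c<1+m) of λ
      { (inj₁ c<m) → settled-mono (m≤m⊔n B₁ B₂) (settled₁ c c<m)
      ; (inj₂ refl) → settled-mono (m≤n⊔m B₁ B₂) settled₂ })

  complement-residue : ∀ {t o c} → t % Q ≡ c % Q → o % Q ≡ ((Q ∸ 1) * c) % Q → (t + o) % Q ≡ 0
  complement-residue {t} {o} {c} t≡c o≡-c = begin
    (t + o) % Q                      ≡⟨ %-distribˡ-+ t o Q ⟩
    (t % Q + o % Q) % Q              ≡⟨ cong₂ (λ u v → (u + v) % Q) t≡c o≡-c ⟩
    (c % Q + (Q ∸ 1) * c % Q) % Q    ≡⟨ %-distribˡ-+ c ((Q ∸ 1) * c) Q ⟨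
    (suc (Q ∸ 1) * c) % Q            ≡⟨ cong (λ q → (q * c) % Q) (m+[n∸m]≡n (>-nonZero⁻¹ Q)) ⟩
    (Q * c) % Q                      ≡⟨ cong (_% Q) (*-comm Q c) ⟩
    (c * Q) % Q                      ≡⟨ m*n%n≡0 c Q ⟩
    0                                ∎
    where open ≡-Reasoning

  align : ∀ B → (∀ c → c < Q → Settled c B) → ∀ {t} → PrefixAt y (B + Q) t →
    ∃ λ i → t ≤ i * Q × i * Q ≤ t + B × PrefixAt y Q (i * Q)
  align B settled {t} prefix with settled (t % Q) (m%n<n t Q)
  ... | inj₁ none = ⊥-elim (none (t , sym (m%n%n≡m%n t Q) , PrefixAt-≤ y (m≤m+n B Q) prefix))
  ... | inj₂ (recurrent , _) with settled ((Q ∸ 1) * (t % Q) % Q) (m%n<n _ Q)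
  ...   | inj₁ none = ⊥-elim (recurrent-% (recurrent-* (Q ∸ 1) recurrent) B none)
  ...   | inj₂ (_ , o , o≡-c , o≤B , prefix-o) =
    t′ / Q , subst (t ≤_) t′≡iQ (m≤m+n t o) , subst (_≤ t + B) t′≡iQ (+-monoʳ-≤ t o≤B) ,
    subst (PrefixAt y Q) t′≡iQ (PrefixAt-+ y (PrefixAt-≤ y (+-monoˡ-≤ Q o≤B) prefix) prefix-o)
    where
    t′ = t + o
    t′≡iQ : t′ ≡ t′ / Q * Q
    t′≡iQ = trans (m≡m%n+[m/n]*n t′ Q)
             (cong (_+ t′ / Q * Q) (complement-residue (sym (m%n%n≡m%n t Q)) (trans o≡-c (m%n%n≡m%n _ Q))))

  almostPeriodic⇒¬¬alignedPrefixRecurs : AlmostPeriodic y → ¬ ¬ ∃ (AlignedPrefixRecurs y Q)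
  almostPeriodic⇒¬¬alignedPrefixRecurs almostPeriodic = do
    B , settled ← ¬¬all-settled Q
    let l , recur = almostPeriodic 0 (B + Q)
    pure (l , λ j →
      let t , j≤t , t+B+Q≤j+l , same = recur j
          i , t≤iQ , iQ≤t+B , prefix = align B settled (factor-≡⁻ y t 0 (B + Q) same)
      in i , ≤-trans j≤t t≤iQ ,
         ≤-trans (+-monoˡ-≤ Q iQ≤t+B) (≤-trans (≤-reflexive (+-assoc t B Q)) t+B+Q≤j+l) , prefix)

module Uniform-morphism-on-Fin {n k : ℕ} (φ : Morphism (Fin n)) (uniform : Uniform k φ) .{{_ : NonZero k}}
                               {Q : Fin n → Set} (Q? : ∀ a → Dec (Q a)) where

  open Uniform-morphism φ uniform

  Contains? : ∀ m a → Dec (Contains Q m a)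
  Contains? m a = map′ (λ (j , q) → toℕ j , Fin.toℕ<n j , q)
    (λ (j , j<k^m , q) → fromℕ< j<k^m , subst (λ i → Q (letter a m i)) (sym (Fin.toℕ-fromℕ< j<k^m)) q)
    (Fin.any? (λ j → Q? (letter a m (toℕ j))))

  contained-everywhere-+ : ∀ t {m} → (∀ a → Contains Q m a) → ∀ a → Contains Q (t + m) a
  contained-everywhere-+ zero    everywhere = everywhere
  contained-everywhere-+ (suc t) {m} everywhere =
    Contains-everywhere-suc Q {t + m} (contained-everywhere-+ t everywhere)

  -- The sets {a | Contains Q m a} evolve by a map of subsets of the alphabet, so they cycle within 2^n steps.
  contained-everywhere-early : (∃ λ m → ∀ a → Contains Q m a) →
    ∀ a → Contains Q (length (allBoolVecs n)) a
  contained-everywhere-early (m , everywhere) a =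
    proj₂ (periodic ≤-refl m) a
      (subst (λ M → Contains Q M a) (m∸n+n≡m m≤M) (contained-everywhere-+ (M ∸ m) everywhere a))
    where
    open Shift-compatible (Contains⊆ Q) (λ _ c → c) (λ m⊆m' m'⊆m'' a c → m'⊆m'' a (m⊆m' a c))
                                      (λ {m} {m'} → Contains⊆-suc Q {m} {m'})
    code : ℕ → Vec Bool n
    code m = characteristic (Contains? m)
    period = eventually-periodic code (allBoolVecs n) (λ m → ∈-allBoolVecs (code m))
               (λ {m} {m'} same a → same-characteristic⇒⊆ (Contains? m) (Contains? m') same)
    p = proj₁ period
    periodic = proj₂ (proj₂ period)
    M = length (allBoolVecs n) + m * p
    m≤M : m ≤ M
    m≤M = ≤-trans (m≤m*n m p {{>-nonZero (proj₁ (proj₂ period))}}) (m≤n+m (m * p) _)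

module Automatic-sequence {n p k : ℕ} {φ : Morphism (Fin n)} (h : Fin n → Fin p) {s : Fin n}
                          (uniform : Uniform k φ) (1<k : 1 < k) {x : ℕ → Fin n} (limit : IsLimit φ s x) where

  instance
    k≢0 : NonZero k
    k≢0 = >-nonZero (<-trans z<s 1<k)

  open Uniform-morphism φ uniform
  open Fixed-point φ uniform 1<k limit

  y : ℕ → Fin p
  y i = h (x i)

  Equiv? : ∀ m → Decidable (Equiv φ h m)
  Equiv? m a b = ≡-dec Fin._≟_ _ _

  Equiv-isEquivalence : ∀ m → IsEquivalence (Equiv φ h m)
  Equiv-isEquivalence m = record { refl = refl ; sym = sym ; trans = trans }

  _∼[_]s : Fin n → ℕ → Set
  b ∼[ r ]s = Equiv φ h r b s

  ∼s⇒aligned-prefix : ∀ M {t} → x t ∼[ M ]s → PrefixAt y (k ^ M) (t * k ^ M)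
  ∼s⇒aligned-prefix M {t} t∼s u u<k^M = begin
    h (x (t * k ^ M + u)) ≡⟨ cong h (x-block M t u<k^M) ⟩
    h (letter (x t) M u)  ≡⟨ Equiv⇒Agree h M t∼s u u<k^M ⟩
    h (letter s M u)      ≡⟨ cong h (x-prefix M u<k^M) ⟨
    h (x u)               ∎
    where open ≡-Reasoning

  aligned-prefix⇒∼s : ∀ r {i} → PrefixAt y (k ^ r) (i * k ^ r) → x i ∼[ r ]s
  aligned-prefix⇒∼s r {i} prefix = Agree⇒Equiv h r λ u u<k^r → begin
    h (letter (x i) r u)  ≡⟨ cong h (x-block r i u<k^r) ⟨
    h (x (i * k ^ r + u)) ≡⟨ prefix u u<k^r ⟩
    h (x u)               ≡⟨ cong h (x-prefix r u<k^r) ⟩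
    h (letter s r u)      ∎
    where open ≡-Reasoning

  Equiv-eventually-periodic : ∀ {r} → bell n ≤ r → ∃ λ q → 0 < q × ∀ j → Equiv⊆ h r (r + j * q)
  Equiv-eventually-periodic {r} bell≤r = q , 0<q , λ j → proj₁ (periodic r≥ j)
    where
    open Shift-compatible (Equiv⊆ h) (λ _ _ e → e) (λ m⊆m' m'⊆m'' a b e → m'⊆m'' a b (m⊆m' a b e))
                          (λ {m} {m'} → Equiv⊆-suc h {m} {m'})
    classes : ∀ m → Labelling (Equiv φ h m)
    classes m = labelling (Equiv? m) (Equiv-isEquivalence m)
    period = eventually-periodic (λ m → Labelling.labels (classes m)) (labellings≤ n n)
      (λ m → ∈-labellings≤ (Labelling.blocks≤n (classes m)) (Labelling.labels∈ (classes m)))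
      (λ {m} {m'} same a b → same-labels⇒⊆ (classes m) (classes m') same)
    q = proj₁ period
    0<q = proj₁ (proj₂ period)
    periodic = proj₂ (proj₂ period)
    r≥ : length (labellings≤ n n) ≤ r
    r≥ = subst (_≤ r) (sym (length-labellings≤ n n)) bell≤r

  syndetic⇒almostPeriodic : ∀ {r} → bell n ≤ r → Syndetic (λ i → x i ∼[ r ]s) → AlmostPeriodic y
  syndetic⇒almostPeriodic {r} bell≤r syndetic i len =
    let q , 0<q , r⊆r+jq = Equiv-eventually-periodic bell≤r
        M = r + (i + len) * q
    in syndetic-copies⇒recurrent y (k ^ M) {{m^n≢0 k M}}
         (syndetic-mono (λ t∼s → r⊆r+jq (i + len) _ s t∼s) syndetic)
         (λ t → ∼s⇒aligned-prefix M) i len (<⇒≤ (i+len<k^M 0<q))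
    where
    i+len<k^M : ∀ {q} → 0 < q → i + len < k ^ (r + (i + len) * q)
    i+len<k^M {q} 0<q = <-≤-trans (n<m^n 1<k (i + len))
      (^-monoʳ-≤ k (≤-trans (m≤m*n (i + len) q {{>-nonZero 0<q}}) (m≤n+m _ r)))

  module _ (r : ℕ) (occurs : ∀ a → ∃ λ i → x i ≡ a) where

    open Uniform-morphism-on-Fin φ uniform (λ b → Equiv? r b s)

    -- The window starting at pa k^l k^r, where x pa = a, is shorter than k^(l+r), so the aligned copy found
    -- there lies in the block x[pa k^l, (pa+1) k^l) = φ^l(a).
    contained-everywhere : ∀ l → AlignedPrefixRecurs y (k ^ r) l → ∀ a → Contains _∼[ r ]s l a
    contained-everywhere l aligned a =
      let i , j≤iQ , iQ+Q≤j+l , prefix = aligned (pa * K * Q)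
          d , d<K , i≡ = within-block {pa} {K} {i} (*-cancelʳ-≤ (pa * K) i Q j≤iQ)
                                                   (*-cancelʳ-< Q i (pa * K + K) (iQ< {i} iQ+Q≤j+l))
      in d , d<K ,
         subst _∼[ r ]s (trans (cong x i≡) (trans (x-block l pa d<K) (cong (λ b → letter b l d) pa≡a)))
                           (aligned-prefix⇒∼s r prefix)
      where
      Q = k ^ r
      K = k ^ l
      instance
        Q≢0 : NonZero Q
        Q≢0 = m^n≢0 k r
      pa = proj₁ (occurs a)
      pa≡a = proj₂ (occurs a)
      iQ< : ∀ {i} → i * Q + Q ≤ pa * K * Q + l → i * Q < (pa * K + K) * Q
      iQ< {i} iQ+Q≤ = begin-strict
        i * Q                 <⟨ m<m+n (i * Q) (m^n>0 k r) ⟩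
        i * Q + Q             ≤⟨ iQ+Q≤ ⟩
        pa * K * Q + l        <⟨ +-monoʳ-< (pa * K * Q) (n<m^n 1<k l) ⟩
        pa * K * Q + K        ≤⟨ +-monoʳ-≤ (pa * K * Q) (m≤m*n K Q) ⟩
        pa * K * Q + K * Q    ≡⟨ *-distribʳ-+ Q (pa * K) K ⟨
        (pa * K + K) * Q      ∎
        where open ≤-Reasoning

    almostPeriodic⇒syndetic : AlmostPeriodic y → Syndetic (λ i → x i ∼[ r ]s)
    almostPeriodic⇒syndetic almostPeriodic = blocks⇒syndetic (k ^ L) {{m^n≢0 k L}} λ i →
      let d , d<K , q = everywhere (x i) in d , d<K , subst _∼[ r ]s (sym (x-block L i d<K)) q
      where
      L = length (allBoolVecs n)
      everywhere : ∀ a → Contains _∼[ r ]s L a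
      everywhere a = decidable-stable (Contains? L a) λ ¬contained →
        Aligned-prefixes.almostPeriodic⇒¬¬alignedPrefixRecurs y (k ^ r) {{m^n≢0 k r}} almostPeriodic
          λ (l , aligned) →
          ¬contained (contained-everywhere-early (l , contained-everywhere l aligned) a)

proposition4 : (n p k : ℕ) (φ : Morphism (Fin n)) (h : Fin n → Fin p) (s : Fin n) →
    Uniform k φ → Prolongable φ s →
    (x : ℕ → Fin n) → IsLimit φ s x →
    ((a : Fin n) → ∃ λ i → x i ≡ a) →
    (r : ℕ) → bell n ≤ r →
    AlmostPeriodic (λ i → h (x i)) ⇔
      (InfiniteSet (λ i → Equiv φ h r (x i) s) × BoundedGaps (λ i → Equiv φ h r (x i) s))
proposition4 n p k φ h s uniform prolongable x limit occurs r bell≤r = mk⇔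
  (λ almostPeriodic → let syndetic = almostPeriodic⇒syndetic r occurs almostPeriodic in
    syndetic⇒infinite syndetic , syndetic⇒boundedGaps syndetic)
  (λ (infinite , gaps) →
    syndetic⇒almostPeriodic bell≤r (infinite∧boundedGaps⇒syndetic (λ i → Equiv? r (x i) s) infinite gaps))
  where open Automatic-sequence h uniform (Uniform-morphism.prolongable⇒1<k φ uniform prolongable) limit
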